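{- Let $G$ be an $n$-vertex graph with $\kappa(G)\ge\alpha(G)$, and let $r=\left\lfloor\frac{\kappa(G)-\alpha(G)}{2}\right\rfloor$. Then $G$ contains $C^r_n$ as a subgraph, i.e. a Hamilton cycle $v_1v_2\cdots v_nv_1$ of $G$ such that the edges $v_1v_3,v_3v_5,\ldots,v_{2r-1}v_{2r+1}$ are also edges of $G$.
   Context: All graphs are finite and simple. $\alpha(G)$ is the independence number of $G$; $\kappa(G)$ is the connectivity of $G$ (the minimum number of vertices whose removal makes $G$ disconnected or reduces it to a single vertex). For integers $\ell\ge3$, $r\ge0$, $C^r_\ell$ denotes the graph consisting of a cycle $v_1v_2\cdots v_\ell v_1$ together with the additional edges $v_1v_3,v_3v_5,\ldots,v_{2r-1}v_{2r+1}$ (for $r=0$ just the cycle). -}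

module Defs where

open import Data.Nat using (ℕ; zero; suc; _+_; _*_; _∸_; _≤_; _<_; ⌊_/2⌋)
open import Data.Bool using (Bool; true; false)
open import Data.Fin using (Fin; toℕ)
open import Data.Fin.Subset using (Subset; _∈_; _∉_; ∣_∣)
open import Data.Product using (Σ; ∃; _×_; _,_)
open import Data.Sum using (_⊎_)
open import Relation.Nullary using (¬_)
open import Relation.Binary.PropositionalEquality using (_≡_)
open import Function.Definitions using (Injective)

record Graph (n : ℕ) : Set where
  field
    adj   : Fin n → Fin n → Bool
    sym   : ∀ u v → adj u v ≡ adj v u
    irr   : ∀ v → adj v v ≡ false

open Graph public

module _ {n : ℕ} (G : Graph n) where

  Independent : Subset n → Set
  Independent S = ∀ u v → u ∈ S → v ∈ S → adj G u v ≡ false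

  IsIndependenceNumber : ℕ → Set
  IsIndependenceNumber a =
    (Σ (Subset n) λ S → Independent S × ∣ S ∣ ≡ a) ×
    (∀ S → Independent S → ∣ S ∣ ≤ a)

  data Reach (S : Subset n) : Fin n → Fin n → Set where
    here : ∀ {u} → u ∉ S → Reach S u u
    step : ∀ {u w v} → Reach S u w → adj G w v ≡ true → v ∉ S → Reach S u v

  Separating : Subset n → Set
  Separating S =
    (n ∸ ∣ S ∣ ≤ 1) ⊎
    (Σ (Fin n) λ u → Σ (Fin n) λ v → u ∉ S × v ∉ S × ¬ Reach S u v)

  IsConnectivity : ℕ → Set
  IsConnectivity k =
    (Σ (Subset n) λ S → Separating S × ∣ S ∣ ≡ k) ×
    (∀ S → Separating S → k ≤ ∣ S ∣)

  -- G contains C^r_n: an ordering v_1,…,v_n of the vertices (v_{i+1} = σ i)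
  -- forming a Hamilton cycle, plus chords v_1v_3, v_3v_5, …, v_{2r-1}v_{2r+1}.
  ContainsCrn : ℕ → Set
  ContainsCrn r =
    Σ (Fin n → Fin n) λ σ →
      Injective _≡_ _≡_ σ ×
      (∀ (i j : Fin n) → toℕ j ≡ suc (toℕ i) → adj G (σ i) (σ j) ≡ true) ×
      (∀ (i j : Fin n) → suc (toℕ i) ≡ n → toℕ j ≡ 0 → adj G (σ i) (σ j) ≡ true) ×
      (∀ (m : ℕ) (i j : Fin n) → m < r → toℕ i ≡ 2 * m → toℕ j ≡ 2 * m + 2 →
         adj G (σ i) (σ j) ≡ true)

-- The argument of Chvátal and Erdős, run with a prescribed segment. Every vertex has at least κ
-- neighbours and any α + 1 vertices span an edge, so while 2m + 1 + α < κ the end of a chain of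
-- m triangles v₁v₂v₃, v₃v₄v₅, … has two adjacent neighbours off the chain, and the chain grows to
-- r triangles. Fewer than κ vertices cannot separate the two ends of the chain, so it closes to a
-- cycle around its interior. A cycle C through the chain is then lengthened until it is
-- Hamiltonian: for h ∉ C let A be the set of vertices of C adjacent to the component of h in
-- G − C, and walk along C from the end of the chain back to its start. Either two consecutive
-- vertices of this walk lie in A, and a detour through the component can be inserted between
-- them, or two vertices of A on it have adjacent successors, and C can be rerouted through the
-- component, or h and these successors form an independent set while A separates h from C. In
-- the last case only the 2r chain vertices before its end lack a successor, so
-- 2r + α ≤ κ ≤ |A| ≤ 2r + (α − 1).

module Submission where

open import Defs renaming (sym to adj-sym; irr to adj-irr)
open import Data.Bool using (true; false)
open import Data.Bool.Properties using (¬-not) renaming (_≟_ to _≟ᵇ_)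
open import Data.Empty using (⊥; ⊥-elim)
open import Data.Fin as Fin using (Fin; zero; suc; toℕ)
import Data.Fin.Properties as Finₚ
open import Data.Fin.Subset as Subset using (Subset; ⁅_⁆; _∪_; _⊆_; ∣_∣)
  renaming (_∈_ to _∈ₛ_; _∉_ to _∉ₛ_)
open import Data.Fin.Subset.Properties
  using (x∈p∪q⁺; x∈p∪q⁻; x∈⁅x⁆; x∈⁅y⁆⇒x≡y; ∉⊥; ∣⁅x⁆∣≡1; ∣⊤∣≡n; ∣p∣≤n;
         p⊆q⇒∣p∣≤∣q∣; p⊂q⇒∣p∣<∣q∣; q⊆p∪q; ∣⊥∣≡0; Empty-unique; nonempty?)
  renaming (_∈?_ to _∈ₛ?_)
open import Data.List
  using (List; []; _∷_; initLast; _∷ʳ′_; _++_; _∷ʳ_; length; map; filter; take; drop; reverse; lookup; allFin)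
open import Data.List.Properties using (length-++; length-map; ++-assoc; take++drop≡id; unfold-reverse)
open import Data.List.Membership.Propositional using (_∈_; _∉_)
open import Data.List.Membership.Propositional.Properties
  using (∈-++⁺ˡ; ∈-++⁺ʳ; ∈-++⁻; ∈-map⁺; ∈-map⁻; ∈-filter⁺; ∈-filter⁻; ∈-allFin; ∈-lookup)
open import Data.List.Relation.Unary.All as All using (All; []; _∷_)
open import Data.List.Relation.Unary.All.Properties using (¬Any⇒All¬; ++⁻ˡ; ++⁻ʳ)
open import Data.List.Relation.Unary.Any using (here; there)
open import Data.List.Relation.Unary.Unique.Propositional
  using (Unique; []; _∷_) renaming (head to Unique-head; tail to Unique-tail)
import Data.List.Relation.Unary.Unique.Propositional.Properties as Unique
open import Data.List.Relation.Binary.Disjoint.Propositional using (Disjoint)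
open import Data.List.Relation.Binary.Disjoint.Propositional.Properties
  using () renaming (sym to Disjoint-sym)
open import Data.List.Relation.Binary.Permutation.Propositional
  using (_↭_; ↭-refl; ↭-sym; ↭⇒↭ₛ; module PermutationReasoning)
open import Data.List.Relation.Binary.Permutation.Propositional.Properties
  using (shifts; ++⁺ˡ; ++⁺ʳ; ↭-reverse; ↭-length; ∷↭∷ʳ)
import Data.List.Relation.Binary.Permutation.Setoid.Properties as ↭ₛ
open import Data.Nat using (ℕ; zero; suc; _+_; _*_; _∸_; _≤_; _<_; z≤n; s≤s; _<?_; ⌊_/2⌋)
open import Data.Nat.Properties
open import Data.Nat.Induction using (<-wellFounded)
open import Induction.WellFounded using (Acc; acc)
open import Data.Product using (∃; ∃₂; _×_; _,_; proj₁; proj₂; uncurry)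
open import Data.Sum using (inj₁; inj₂; [_,_])
open import Data.Unit using (⊤; tt)
open import Data.Vec using ([]; _∷_)
open import Function using (_∘_)
open import Relation.Binary.Definitions using (tri<; tri≈; tri>)
open import Relation.Binary.PropositionalEquality
  using (_≡_; _≢_; refl; sym; trans; cong; cong₂; subst; subst₂; setoid; module ≡-Reasoning)
open import Relation.Nullary using (¬_; Dec; yes; no; ¬?; contradiction)
open import Relation.Nullary.Decidable using (_×-dec_; map′; decidable-stable)
open import Relation.Unary using (Decidable)

module _ {A : Set} where

  lastOr : A → List A → A
  lastOr p []       = p
  lastOr p (x ∷ xs) = lastOr x xs

  headOr : A → List A → A
  headOr d []      = d
  headOr d (x ∷ _) = x

  init : A → List A → List A
  init x []       = []
  init x (y ∷ ys) = x ∷ init y ys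

  lastOr-++ : ∀ p xs ys → lastOr p (xs ++ ys) ≡ lastOr (lastOr p xs) ys
  lastOr-++ p []       ys = refl
  lastOr-++ p (x ∷ xs) ys = lastOr-++ x xs ys

  lastOr-∷ʳ : ∀ p xs x → lastOr p (xs ∷ʳ x) ≡ x
  lastOr-∷ʳ p xs x = lastOr-++ p xs (x ∷ [])

  lastOr-reverse : ∀ p x xs → lastOr p (reverse (x ∷ xs)) ≡ x
  lastOr-reverse p x xs = trans (cong (lastOr p) (unfold-reverse x xs)) (lastOr-∷ʳ p (reverse xs) x)

  ∷≡init∷ʳlastOr : ∀ x xs → x ∷ xs ≡ init x xs ∷ʳ lastOr x xs
  ∷≡init∷ʳlastOr x []       = refl
  ∷≡init∷ʳlastOr x (y ∷ ys) = cong (x ∷_) (∷≡init∷ʳlastOr y ys)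

  length-init : ∀ x xs → length (init x xs) ≡ length xs
  length-init x []       = refl
  length-init x (y ∷ ys) = cong suc (length-init y ys)

  lastOr-∈ : ∀ p xs → lastOr p xs ∈ p ∷ xs
  lastOr-∈ p []       = here refl
  lastOr-∈ p (x ∷ xs) = there (lastOr-∈ x xs)

  unique-∷ : ∀ {x} {xs : List A} → x ∉ xs → Unique xs → Unique (x ∷ xs)
  unique-∷ {xs = xs} x∉xs xs! = ¬Any⇒All¬ xs x∉xs ∷ xs!

  unique-++⁻ : ∀ (xs : List A) {ys} → Unique (xs ++ ys) → Unique xs × Unique ys × Disjoint xs ys
  unique-++⁻ []       ys!           = [] , ys! , λ ()
  unique-++⁻ (x ∷ xs) (x∉ ∷ xsys!) with unique-++⁻ xs xsys!
  ... | xs! , ys! , xs#ys = ++⁻ˡ xs x∉ ∷ xs! , ys! , λ where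
    (here refl , x∈ys) → All.lookup (++⁻ʳ xs x∉) x∈ys refl
    (there v∈xs , v∈ys) → xs#ys (v∈xs , v∈ys)

  unique-↭ : ∀ {xs ys : List A} → xs ↭ ys → Unique xs → Unique ys
  unique-↭ xs↭ys = ↭ₛ.Unique-resp-↭ (setoid A) (↭⇒↭ₛ xs↭ys)

  lookup-injective : ∀ {xs : List A} → Unique xs → ∀ {i j} → lookup xs i ≡ lookup xs j → i ≡ j
  lookup-injective {_ ∷ _} (_  ∷ _)   {zero}  {zero}  _ = refl
  lookup-injective {_ ∷ _} (x∉ ∷ _)   {zero}  {suc j} e = ⊥-elim (All.lookup x∉ (∈-lookup j) e)
  lookup-injective {_ ∷ _} (x∉ ∷ _)   {suc i} {zero}  e = ⊥-elim (All.lookup x∉ (∈-lookup i) (sym e))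
  lookup-injective {_ ∷ _} (_  ∷ xs!) {suc i} {suc j} e = cong suc (lookup-injective xs! e)

  lookup-zero : ∀ {x : A} {xs} (i : Fin (length (x ∷ xs))) → toℕ i ≡ 0 → lookup (x ∷ xs) i ≡ x
  lookup-zero zero _ = refl

  lookup-last : ∀ p xs (i : Fin (length (p ∷ xs))) → toℕ i ≡ length xs → lookup (p ∷ xs) i ≡ lastOr p xs
  lookup-last p []       zero    _ = refl
  lookup-last p (x ∷ xs) (suc i) e = lookup-last x xs i (suc-injective e)

  ∈⇒lastOr-take : ∀ {v p} xs → v ∈ p ∷ xs → ∃ λ (i : Fin (suc (length xs))) → v ≡ lastOr p (take (toℕ i) xs)
  ∈⇒lastOr-take xs       (here v≡p)  = zero , v≡p
  ∈⇒lastOr-take (x ∷ xs) (there v∈) with ∈⇒lastOr-take xs v∈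
  ... | i , v≡ = suc i , v≡

  headOr-drop-∈ : ∀ d xs (i : Fin (suc (length xs))) → headOr d (drop (toℕ i) xs) ∈ xs ∷ʳ d
  headOr-drop-∈ d []       zero    = here refl
  headOr-drop-∈ d (x ∷ xs) zero    = here refl
  headOr-drop-∈ d (x ∷ xs) (suc i) = there (headOr-drop-∈ d xs i)

  headOr-drop-injective : ∀ d xs → Unique (xs ∷ʳ d) → ∀ {i j : Fin (suc (length xs))} →
    headOr d (drop (toℕ i) xs) ≡ headOr d (drop (toℕ j) xs) → i ≡ j
  headOr-drop-injective d []       _          {zero}  {zero}  _ = refl
  headOr-drop-injective d (x ∷ xs) _          {zero}  {zero}  _ = refl
  headOr-drop-injective d (x ∷ xs) (x∉ ∷ _)   {zero}  {suc j} e = ⊥-elim (All.lookup x∉ (headOr-drop-∈ d xs j) e)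
  headOr-drop-injective d (x ∷ xs) (x∉ ∷ _)   {suc i} {zero}  e = ⊥-elim (All.lookup x∉ (headOr-drop-∈ d xs i) (sym e))
  headOr-drop-injective d (x ∷ xs) (_ ∷ xs!) {suc i} {suc j} e = cong suc (headOr-drop-injective d xs xs! e)

  split-between : ∀ d xs (i j : Fin (suc (length xs))) → i Fin.< j →
    ∃₂ λ ys z → ∃₂ λ zs ws → xs ≡ ys ++ z ∷ zs ++ ws ×
      take (toℕ i) xs ≡ ys × headOr d (drop (toℕ i) xs) ≡ z ×
      take (toℕ j) xs ≡ ys ++ z ∷ zs × drop (toℕ j) xs ≡ ws
  split-between d (x ∷ xs) zero (suc j) _ =
    [] , x , take (toℕ j) xs , drop (toℕ j) xs ,
    cong (x ∷_) (sym (take++drop≡id (toℕ j) xs)) , refl , refl , refl , refl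
  split-between d (x ∷ xs) (suc i) (suc j) (s≤s i<j) with split-between d xs i j i<j
  ... | ys , z , zs , ws , xs≡ , take-i , head-i , take-j , drop-j =
    x ∷ ys , z , zs , ws , cong (x ∷_) xs≡ , cong (x ∷_) take-i , head-i , cong (x ∷_) take-j , drop-j

∣p∪q∣≤∣p∣+∣q∣ : ∀ {n} (p q : Subset n) → ∣ p ∪ q ∣ ≤ ∣ p ∣ + ∣ q ∣
∣p∪q∣≤∣p∣+∣q∣ []          []          = z≤n
∣p∪q∣≤∣p∣+∣q∣ (true ∷ p)  (true ∷ q)  = s≤s (≤-trans (∣p∪q∣≤∣p∣+∣q∣ p q) (+-monoʳ-≤ ∣ p ∣ (n≤1+n ∣ q ∣)))
∣p∪q∣≤∣p∣+∣q∣ (true ∷ p)  (false ∷ q) = s≤s (∣p∪q∣≤∣p∣+∣q∣ p q)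
∣p∪q∣≤∣p∣+∣q∣ (false ∷ p) (true ∷ q)  = ≤-trans (s≤s (∣p∪q∣≤∣p∣+∣q∣ p q)) (≤-reflexive (sym (+-suc ∣ p ∣ ∣ q ∣)))
∣p∪q∣≤∣p∣+∣q∣ (false ∷ p) (false ∷ q) = ∣p∪q∣≤∣p∣+∣q∣ p q

module _ {n : ℕ} where

  fromList : List (Fin n) → Subset n
  fromList []       = Subset.⊥
  fromList (x ∷ xs) = ⁅ x ⁆ ∪ fromList xs

  ∈-fromList⁺ : ∀ {v xs} → v ∈ xs → v ∈ₛ fromList xs
  ∈-fromList⁺ (here refl)  = x∈p∪q⁺ (inj₁ (x∈⁅x⁆ _))
  ∈-fromList⁺ (there v∈xs) = x∈p∪q⁺ (inj₂ (∈-fromList⁺ v∈xs))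

  ∈-fromList⁻ : ∀ {v} xs → v ∈ₛ fromList xs → v ∈ xs
  ∈-fromList⁻ []       v∈ = ⊥-elim (∉⊥ v∈)
  ∈-fromList⁻ (x ∷ xs) v∈ = [ here ∘ x∈⁅y⁆⇒x≡y x , there ∘ ∈-fromList⁻ xs ] (x∈p∪q⁻ ⁅ x ⁆ (fromList xs) v∈)

  ∣fromList∣≤length : ∀ xs → ∣ fromList xs ∣ ≤ length xs
  ∣fromList∣≤length []       = ≤-reflexive (∣⊥∣≡0 n)
  ∣fromList∣≤length (x ∷ xs) = begin
    ∣ ⁅ x ⁆ ∪ fromList xs ∣       ≤⟨ ∣p∪q∣≤∣p∣+∣q∣ ⁅ x ⁆ (fromList xs) ⟩
    ∣ ⁅ x ⁆ ∣ + ∣ fromList xs ∣   ≡⟨ cong (_+ ∣ fromList xs ∣) (∣⁅x⁆∣≡1 x) ⟩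
    suc ∣ fromList xs ∣           ≤⟨ s≤s (∣fromList∣≤length xs) ⟩
    suc (length xs)               ∎
    where open ≤-Reasoning

  unique⇒length≤∣fromList∣ : ∀ {xs} → Unique xs → length xs ≤ ∣ fromList xs ∣
  unique⇒length≤∣fromList∣ []                    = z≤n
  unique⇒length≤∣fromList∣ {x ∷ xs} (x∉ ∷ xs!) =
    ≤-trans (s≤s (unique⇒length≤∣fromList∣ {xs} xs!)) (p⊂q⇒∣p∣<∣q∣ ⊂)
    where
    ⊂ : fromList xs Subset.⊂ fromList (x ∷ xs)
    ⊂ = q⊆p∪q ⁅ x ⁆ (fromList xs) , x , ∈-fromList⁺ {xs = x ∷ xs} (here refl) ,
        λ x∈ → All.lookup x∉ (∈-fromList⁻ xs x∈) refl

  unique⇒length≤n : ∀ {xs} → Unique xs → length xs ≤ n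
  unique⇒length≤n {xs} xs! = ≤-trans (unique⇒length≤∣fromList∣ xs!) (∣p∣≤n (fromList xs))

  short-list-misses : ∀ xs → length xs < n → ∃ λ v → v ∉ xs
  short-list-misses xs short with Finₚ.any? (λ v → ¬? (v ∈ₛ? fromList xs))
  ... | yes (v , v∉) = v , v∉ ∘ ∈-fromList⁺
  ... | no none = ⊥-elim (<⇒≱ short (begin
    n                     ≡⟨ ∣⊤∣≡n n ⟨
    ∣ Subset.⊤ {n} ∣      ≤⟨ p⊆q⇒∣p∣≤∣q∣ {p = Subset.⊤} {q = fromList xs} (λ {v} _ → everywhere v) ⟩
    ∣ fromList xs ∣       ≤⟨ ∣fromList∣≤length xs ⟩
    length xs             ∎))
    where
    open ≤-Reasoning
    everywhere : ∀ v → v ∈ₛ fromList xs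
    everywhere v = decidable-stable (v ∈ₛ? fromList xs) (λ v∉ → none (v , v∉))

  decSubset : {P : Fin n → Set} → Decidable P → Subset n
  decSubset P? = fromList (filter P? (allFin n))

  ∈-decSubset⁺ : ∀ {P : Fin n → Set} (P? : Decidable P) {v} → P v → v ∈ₛ decSubset P?
  ∈-decSubset⁺ P? {v} pv = ∈-fromList⁺ (∈-filter⁺ P? (∈-allFin v) pv)

  ∈-decSubset⁻ : ∀ {P : Fin n → Set} (P? : Decidable P) {v} → v ∈ₛ decSubset P? → P v
  ∈-decSubset⁻ P? v∈ = proj₂ (∈-filter⁻ P? {xs = allFin n} (∈-fromList⁻ _ v∈))

  avoids⇒disjoint : ∀ {xs ys : List (Fin n)} → All (_∉ₛ fromList ys) xs → Disjoint xs ys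
  avoids⇒disjoint avoids (v∈xs , v∈ys) = All.lookup avoids v∈xs (∈-fromList⁺ v∈ys)

module Walks {n : ℕ} (G : Graph n) where

  open import Data.List.Membership.DecPropositional (Finₚ._≟_ {n}) using (_∈?_) public

  infix 4 _~_ _~?_

  _~_ : Fin n → Fin n → Set
  u ~ v = adj G u v ≡ true

  _~?_ : ∀ u v → Dec (u ~ v)
  u ~? v = adj G u v ≟ᵇ true

  ~-sym : ∀ {u v} → u ~ v → v ~ u
  ~-sym {u} {v} u~v = trans (adj-sym G v u) u~v

  ~-irrefl : ∀ {v} → ¬ v ~ v
  ~-irrefl {v} v~v with () ← trans (sym (adj-irr G v)) v~v

  Walk : Fin n → List (Fin n) → Set
  Walk p []       = ⊤
  Walk p (x ∷ xs) = p ~ x × Walk x xs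

  WalkTo : Fin n → List (Fin n) → Fin n → Set
  WalkTo p []       t = p ~ t
  WalkTo p (x ∷ xs) t = p ~ x × WalkTo x xs t

  walk-++⁺ : ∀ {p} xs {ys} → Walk p xs → Walk (lastOr p xs) ys → Walk p (xs ++ ys)
  walk-++⁺ []       _              w = w
  walk-++⁺ (x ∷ xs) (p~x , walk) w = p~x , walk-++⁺ xs walk w

  walkTo-++⁺ : ∀ {p t} xs {ys} → Walk p xs → WalkTo (lastOr p xs) ys t → WalkTo p (xs ++ ys) t
  walkTo-++⁺ []       _              w = w
  walkTo-++⁺ (x ∷ xs) (p~x , walk) w = p~x , walkTo-++⁺ xs walk w

  walkTo-++⁻ : ∀ {p t} xs {ys} → WalkTo p (xs ++ ys) t → Walk p xs × WalkTo (lastOr p xs) ys t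
  walkTo-++⁻ []       w           = tt , w
  walkTo-++⁻ (x ∷ xs) (p~x , w) with walkTo-++⁻ xs w
  ... | walk , w′ = (p~x , walk) , w′

  walkTo⇒walk : ∀ {p t} xs → WalkTo p xs t → Walk p xs
  walkTo⇒walk []       _         = tt
  walkTo⇒walk (x ∷ xs) (p~x , w) = p~x , walkTo⇒walk xs w

  walkTo-last : ∀ {p t} xs → WalkTo p xs t → lastOr p xs ~ t
  walkTo-last []       p~t     = p~t
  walkTo-last (x ∷ xs) (_ , w) = walkTo-last xs w

  walkTo-restart : ∀ {p p′ t} ys → WalkTo p ys t → p′ ~ headOr t ys → WalkTo p′ ys t
  walkTo-restart []       _           p′~t = p′~t
  walkTo-restart (y ∷ ys) (_ , w) p′~y = p′~y , w

  walk-∷ʳ⇒walkTo : ∀ {p} xs {t} → Walk p (xs ∷ʳ t) → WalkTo p xs t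
  walk-∷ʳ⇒walkTo []       (p~t , _) = p~t
  walk-∷ʳ⇒walkTo (x ∷ xs) (p~x , w) = p~x , walk-∷ʳ⇒walkTo xs w

  walk-reverse : ∀ {b z} M → Walk z M → b ~ lastOr z M → Walk b (reverse (z ∷ M))
  walk-reverse []       _            b~z = b~z , tt
  walk-reverse {b} {z} (m ∷ M) (z~m , walk) b~last =
    subst (Walk b) (sym (unfold-reverse z (m ∷ M)))
      (walk-++⁺ (reverse (m ∷ M)) (walk-reverse M walk b~last)
        (subst (_~ z) (sym (lastOr-reverse b m M)) (~-sym z~m) , tt))

  walk-lookup : ∀ {p xs} → Walk p xs → ∀ (i j : Fin (length (p ∷ xs))) →
    toℕ j ≡ suc (toℕ i) → lookup (p ∷ xs) i ~ lookup (p ∷ xs) j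
  walk-lookup {xs = x ∷ xs} (p~x , _) zero    (suc zero) refl = p~x
  walk-lookup {xs = x ∷ xs} (_ , w)   (suc i) (suc j)    e    = walk-lookup w i j (suc-injective e)

  record AvoidingWalk (S : Subset n) (v : Fin n) (xs : List (Fin n)) (u : Fin n) : Set where
    constructor avoidingWalk
    field
      walk   : Walk v xs
      ends   : lastOr v xs ≡ u
      avoids : All (_∉ₛ S) (v ∷ xs)

  Path : Subset n → Fin n → Fin n → Set
  Path S v u = ∃ λ xs → AvoidingWalk S v xs u × Unique (v ∷ xs)

  reach-end : ∀ {S u v} → Reach G S u v → v ∉ₛ S
  reach-end (here v∉S)     = v∉S
  reach-end (step _ _ v∉S) = v∉S

  reach-trans : ∀ {S u v w} → Reach G S u v → Reach G S v w → Reach G S u w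
  reach-trans r (here _)          = r
  reach-trans r (step r′ w~v v∉S) = step (reach-trans r r′) w~v v∉S

  reach-sym : ∀ {S u v} → Reach G S u v → Reach G S v u
  reach-sym (here u∉S)        = here u∉S
  reach-sym (step r w~v v∉S) = reach-trans (step (here v∉S) (~-sym w~v) (reach-end r)) (reach-sym r)

  avoidingWalk⇒reach : ∀ {S v xs u} → AvoidingWalk S v xs u → Reach G S u v
  avoidingWalk⇒reach {xs = []}     (avoidingWalk _ refl (v∉S ∷ [])) = here v∉S
  avoidingWalk⇒reach {xs = x ∷ xs} (avoidingWalk (v~x , walk) ends (v∉S ∷ avoids)) =
    step (avoidingWalk⇒reach (avoidingWalk walk ends avoids)) (~-sym v~x) v∉S

  shortcut : ∀ {S w ws u v} → AvoidingWalk S w ws u → Unique (w ∷ ws) → v ∈ w ∷ ws → Path S v u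
  shortcut aw ws! (here refl) = _ , aw , ws!
  shortcut {ws = x ∷ xs} (avoidingWalk (_ , walk) ends (_ ∷ avoids)) (_ ∷ xs!) (there v∈) =
    shortcut (avoidingWalk walk ends avoids) xs! v∈

  reach⇒path : ∀ {S u v} → Reach G S u v → Path S v u
  reach⇒path (here u∉S) = [] , avoidingWalk tt refl (u∉S ∷ []) , [] ∷ []
  reach⇒path {v = v} (step {w = w} r w~v v∉S) with reach⇒path r
  ... | ws , aw , ws! with v ∈? (w ∷ ws)
  ...   | yes v∈ = shortcut aw ws! v∈
  ...   | no v∉  = w ∷ ws , avoidingWalk (~-sym w~v , walk) ends (v∉S ∷ avoids) , unique-∷ v∉ ws!
    where open AvoidingWalk aw

  WalkOfLength : Subset n → ℕ → Fin n → Fin n → Set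
  WalkOfLength S m v u = ∃ λ xs → length xs ≡ m × AvoidingWalk S v xs u

  walkOfLength? : ∀ S m v u → Dec (WalkOfLength S m v u)
  walkOfLength? S zero v u = map′ to from ((v Finₚ.≟ u) ×-dec ¬? (v ∈ₛ? S))
    where
    to : v ≡ u × v ∉ₛ S → WalkOfLength S 0 v u
    to (v≡u , v∉S) = [] , refl , avoidingWalk tt v≡u (v∉S ∷ [])
    from : WalkOfLength S 0 v u → v ≡ u × v ∉ₛ S
    from ([] , _ , avoidingWalk _ v≡u (v∉S ∷ [])) = v≡u , v∉S
  walkOfLength? S (suc m) v u =
    map′ to from (Finₚ.any? λ w → (v ~? w) ×-dec ¬? (v ∈ₛ? S) ×-dec walkOfLength? S m w u)
    where
    to : (∃ λ w → v ~ w × v ∉ₛ S × WalkOfLength S m w u) → WalkOfLength S (suc m) v u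
    to (w , v~w , v∉S , xs , len , avoidingWalk walk ends avoids) =
      w ∷ xs , cong suc len , avoidingWalk (v~w , walk) ends (v∉S ∷ avoids)
    from : WalkOfLength S (suc m) v u → ∃ λ w → v ~ w × v ∉ₛ S × WalkOfLength S m w u
    from (w ∷ xs , len , avoidingWalk (v~w , walk) ends (v∉S ∷ avoids)) =
      w , v~w , v∉S , xs , suc-injective len , avoidingWalk walk ends avoids

  -- A walk can be shortcut to one with distinct vertices, so walks shorter than n suffice.
  reach? : ∀ S u v → Dec (Reach G S u v)
  reach? S u v = map′ (λ (_ , _ , _ , _ , aw) → avoidingWalk⇒reach aw) shorter-than-n
    (anyUpTo? (λ m → walkOfLength? S m v u) n)
    where
    shorter-than-n : Reach G S u v → ∃ λ m → m < n × WalkOfLength S m v u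
    shorter-than-n r with reach⇒path r
    ... | xs , aw , xs! = length xs , unique⇒length≤n xs! , xs , refl , aw

module Hamiltonian {n : ℕ} (G : Graph n) {a k : ℕ}
  (α-bound : ∀ S → Independent G S → ∣ S ∣ ≤ a)
  (κ-bound : ∀ S → Separating G S → k ≤ ∣ S ∣)
  where

  open Walks G

  pairwise-nonadjacent⇒independent : ∀ {xs} → (∀ {u v} → u ∈ xs → v ∈ xs → u ≢ v → ¬ u ~ v) →
    Independent G (fromList xs)
  pairwise-nonadjacent⇒independent {xs} nonadjacent u v u∈ v∈ with u Finₚ.≟ v
  ... | yes refl = adj-irr G u
  ... | no u≢v   = ¬-not (nonadjacent (∈-fromList⁻ xs u∈) (∈-fromList⁻ xs v∈) u≢v)

  1≤a : Fin n → 1 ≤ a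
  1≤a v = ≤-trans (≤-reflexive (sym (∣⁅x⁆∣≡1 v))) (α-bound ⁅ v ⁆ singleton)
    where
    singleton : Independent G ⁅ v ⁆
    singleton u w u∈ w∈ rewrite x∈⁅y⁆⇒x≡y v u∈ | x∈⁅y⁆⇒x≡y v w∈ = adj-irr G v

  edge-inside : ∀ {X} → a < ∣ X ∣ → ∃₂ λ x y → x ∈ₛ X × y ∈ₛ X × x ~ y
  edge-inside {X} a<∣X∣ with Finₚ.any? (λ x → Finₚ.any? (λ y → (x ∈ₛ? X) ×-dec (y ∈ₛ? X) ×-dec (x ~? y)))
  ... | yes edge = edge
  ... | no none  = ⊥-elim (<⇒≱ a<∣X∣ (α-bound X λ u v u∈ v∈ → ¬-not λ u~v → none (u , v , u∈ , v∈ , u~v)))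

  neighbours : Fin n → Subset n
  neighbours v = decSubset (v ~?_)

  trapped-by-neighbours : ∀ {v w} → Reach G (neighbours v) v w → w ≡ v
  trapped-by-neighbours (here _) = refl
  trapped-by-neighbours {v} (step r w~u u∉N) with trapped-by-neighbours r
  ... | refl = ⊥-elim (u∉N (∈-decSubset⁺ (v ~?_) w~u))

  κ≤degree : ∀ v → k ≤ ∣ neighbours v ∣
  κ≤degree v = κ-bound (neighbours v) separating
    where
    v∉N : v ∉ₛ neighbours v
    v∉N = ~-irrefl ∘ ∈-decSubset⁻ (v ~?_)

    separating : Separating G (neighbours v)
    separating with Finₚ.any? (λ u → ¬? (u Finₚ.≟ v) ×-dec ¬? (u ∈ₛ? neighbours v))
    ... | yes (u , u≢v , u∉N) = inj₂ (v , u , v∉N , u∉N , u≢v ∘ trapped-by-neighbours)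
    ... | no none = inj₁ (m≤n+o⇒m∸n≤o n ∣ neighbours v ∣ (begin
      n                                    ≡⟨ ∣⊤∣≡n n ⟨
      ∣ Subset.⊤ {n} ∣                     ≤⟨ p⊆q⇒∣p∣≤∣q∣ {p = Subset.⊤} (λ {u} _ → covered u) ⟩
      ∣ neighbours v ∪ ⁅ v ⁆ ∣             ≤⟨ ∣p∪q∣≤∣p∣+∣q∣ (neighbours v) ⁅ v ⁆ ⟩
      ∣ neighbours v ∣ + ∣ ⁅ v ⁆ ∣         ≡⟨ cong (∣ neighbours v ∣ +_) (∣⁅x⁆∣≡1 v) ⟩
      ∣ neighbours v ∣ + 1                 ∎))
      where
      open ≤-Reasoning
      covered : ∀ u → u ∈ₛ neighbours v ∪ ⁅ v ⁆
      covered u with u Finₚ.≟ v | u ∈ₛ? neighbours v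
      ... | yes refl | _       = x∈p∪q⁺ (inj₂ (x∈⁅x⁆ v))
      ... | no _     | yes u∈N = x∈p∪q⁺ (inj₁ u∈N)
      ... | no u≢v   | no u∉N  = ⊥-elim (none (u , u≢v , u∉N))

  -- x ∷ vs = v₁ v₂ … v₂ᵣ₊₁ is a path whose triangles v₁v₂v₃, v₃v₄v₅, … supply the chords of C^r.
  TriangleChain : ℕ → Fin n → List (Fin n) → Set
  TriangleChain zero    x []           = ⊤
  TriangleChain (suc r) x (y ∷ z ∷ vs) = x ~ y × y ~ z × x ~ z × TriangleChain r z vs
  TriangleChain _       _ _            = ⊥

  chain-length : ∀ {r x} vs → TriangleChain r x vs → length vs ≡ r + r
  chain-length {zero}  []           _                 = refl
  chain-length {suc r} (y ∷ z ∷ vs) (_ , _ , _ , chain) =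
    cong suc (trans (cong suc (chain-length vs chain)) (sym (+-suc r r)))

  chain-walk : ∀ {r x} vs → TriangleChain r x vs → Walk x vs
  chain-walk {zero}  []           _                       = tt
  chain-walk {suc r} (y ∷ z ∷ vs) (x~y , y~z , _ , chain) = x~y , y~z , chain-walk vs chain

  -- Stated with m * 2 rather than 2 * m so that suc m * 2 reduces to suc (suc (m * 2)).
  chain-chord : ∀ {r x} vs ys → TriangleChain r x vs → ∀ {m} → m < r →
    ∀ (i j : Fin (length (x ∷ vs ++ ys))) → toℕ i ≡ m * 2 → toℕ j ≡ suc (suc (m * 2)) →
    lookup (x ∷ vs ++ ys) i ~ lookup (x ∷ vs ++ ys) j
  chain-chord {suc r} (y ∷ z ∷ vs) ys (_ , _ , x~z , _) {zero} _ zero (suc (suc zero)) refl refl = x~z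
  chain-chord {suc r} (y ∷ z ∷ vs) ys (_ , _ , _ , chain) {suc m} (s≤s m<r)
    (suc (suc i)) (suc (suc j)) i≡ j≡ =
    chain-chord vs ys chain m<r i j (suc-injective (suc-injective i≡)) (suc-injective (suc-injective j≡))

  extend-chain : ∀ {m v} vs → TriangleChain m v vs → Unique (v ∷ vs) → length (v ∷ vs) + a < k →
    ∃₂ λ y ys → TriangleChain (suc m) y ys × Unique (y ∷ ys)
  extend-chain {m} {v} vs chain vs! bound = grow (edge-inside a<∣fresh∣)
    where
    Fresh? : ∀ u → Dec (v ~ u × u ∉ v ∷ vs)
    Fresh? u = (v ~? u) ×-dec ¬? (u ∈? v ∷ vs)

    fresh : Subset n
    fresh = decSubset Fresh?

    covered : neighbours v ⊆ fresh ∪ fromList (v ∷ vs)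
    covered {u} u∈N with u ∈? v ∷ vs
    ... | yes u∈ = x∈p∪q⁺ (inj₂ (∈-fromList⁺ u∈))
    ... | no u∉  = x∈p∪q⁺ (inj₁ (∈-decSubset⁺ Fresh? (∈-decSubset⁻ (v ~?_) u∈N , u∉)))

    a<∣fresh∣ : a < ∣ fresh ∣
    a<∣fresh∣ = +-cancelˡ-< (length (v ∷ vs)) a ∣ fresh ∣ (begin-strict
      length (v ∷ vs) + a                        <⟨ bound ⟩
      k                                          ≤⟨ κ≤degree v ⟩
      ∣ neighbours v ∣                           ≤⟨ p⊆q⇒∣p∣≤∣q∣ covered ⟩
      ∣ fresh ∪ fromList (v ∷ vs) ∣              ≤⟨ ∣p∪q∣≤∣p∣+∣q∣ fresh (fromList (v ∷ vs)) ⟩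
      ∣ fresh ∣ + ∣ fromList (v ∷ vs) ∣          ≤⟨ +-monoʳ-≤ ∣ fresh ∣ (∣fromList∣≤length (v ∷ vs)) ⟩
      ∣ fresh ∣ + length (v ∷ vs)                ≡⟨ +-comm ∣ fresh ∣ (length (v ∷ vs)) ⟩
      length (v ∷ vs) + ∣ fresh ∣                ∎)
      where open ≤-Reasoning

    grow : (∃₂ λ x y → x ∈ₛ fresh × y ∈ₛ fresh × x ~ y) →
      ∃₂ λ y ys → TriangleChain (suc m) y ys × Unique (y ∷ ys)
    grow (x , y , x∈ , y∈ , x~y) with ∈-decSubset⁻ Fresh? x∈ | ∈-decSubset⁻ Fresh? y∈
    ... | v~x , x∉ | v~y , y∉ =
      y , x ∷ v ∷ vs , (~-sym x~y , ~-sym v~x , ~-sym v~y , chain) , unique-∷ y∉′ (unique-∷ x∉ vs!)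
      where
      y∉′ : y ∉ x ∷ v ∷ vs
      y∉′ (here refl) = ~-irrefl x~y
      y∉′ (there y∈)  = y∉ y∈

  build-chain : Fin n → ∀ r → r + r + a ≤ k → ∃₂ λ v vs → TriangleChain r v vs × Unique (v ∷ vs)
  build-chain v₀ zero    _     = v₀ , [] , tt , [] ∷ []
  build-chain v₀ (suc r) bound with build-chain v₀ r (≤-trans (+-monoˡ-≤ a (+-mono-≤ (n≤1+n r) (n≤1+n r))) bound)
  ... | v , vs , chain , vs! =
    extend-chain vs chain vs! (subst (λ l → 2 + l + a ≤ k) (sym (chain-length vs chain)) room)
    where
    room : 2 + (r + r) + a ≤ k
    room = subst (λ l → suc l + a ≤ k) (+-suc r r) bound

  -- The path t ∷ T is kept; D closes it into the cycle t ∷ T ++ D.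
  Closes : Fin n → List (Fin n) → List (Fin n) → Set
  Closes t T D = Unique (t ∷ T ++ D) × WalkTo (lastOr t T) D t

  module Extension (t : Fin n) (T : List (Fin n)) (T+a≤k : length T + a ≤ k) where

    q : Fin n
    q = lastOr t T

    cycle : List (Fin n) → List (Fin n)
    cycle D = t ∷ T ++ D

    Longer : List (Fin n) → Set
    Longer D = ∃ λ D′ → Closes t T D′ × length D < length D′

    -- B′ ↭ B lets one lemma serve both plain insertion (B′ = B) and rerouting (a reversed segment).
    splice : ∀ D₁ {B B′} X → B′ ↭ B → Unique (cycle (D₁ ++ B)) → Unique X →
      Disjoint X (cycle (D₁ ++ B)) → WalkTo q (D₁ ++ X ++ B′) t → 0 < length X → Longer (D₁ ++ B)
    splice D₁ {B} {B′} X B′↭B unique X! X#cycle walk 0<∣X∣ =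
      D₁ ++ X ++ B′ , (unique-↭ (↭-sym rearranged) (Unique.++⁺ X! unique X#cycle) , walk) , longer
      where
      F : List (Fin n)
      F = t ∷ T ++ D₁

      rearranged : cycle (D₁ ++ X ++ B′) ↭ X ++ cycle (D₁ ++ B)
      rearranged = begin
        t ∷ T ++ D₁ ++ X ++ B′  ≡⟨ cong (t ∷_) (++-assoc T D₁ (X ++ B′)) ⟨
        F ++ X ++ B′            ↭⟨ shifts F X ⟩
        X ++ F ++ B′            ↭⟨ ++⁺ˡ X (++⁺ˡ F B′↭B) ⟩
        X ++ F ++ B             ≡⟨ cong (λ xs → X ++ t ∷ xs) (++-assoc T D₁ B) ⟩
        X ++ t ∷ T ++ D₁ ++ B   ∎
        where open PermutationReasoning

      longer : length (D₁ ++ B) < length (D₁ ++ X ++ B′)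
      longer = begin-strict
        length (D₁ ++ B)                    ≡⟨ length-++ D₁ ⟩
        length D₁ + length B                ≡⟨ cong (length D₁ +_) (↭-length B′↭B) ⟨
        length D₁ + length B′               <⟨ +-monoʳ-< (length D₁) (m<n+m (length B′) 0<∣X∣) ⟩
        length D₁ + (length X + length B′)  ≡⟨ cong (length D₁ +_) (length-++ X) ⟨
        length D₁ + length (X ++ B′)        ≡⟨ length-++ D₁ ⟨
        length (D₁ ++ X ++ B′)              ∎
        where open ≤-Reasoning

    insert : ∀ {D} D₁ B → D ≡ D₁ ++ B → Closes t T D → ∀ {u w} →
      lastOr q D₁ ~ u → w ~ headOr t B → Path (fromList (cycle D)) u w → Longer D
    insert D₁ B refl (unique , walk) {u} x~u w~y (ys , avoidingWalk walk-ys refl avoids , ys!)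
      with walkTo-++⁻ D₁ walk
    ... | walk-D₁ , walk-B =
      splice D₁ (u ∷ ys) ↭-refl unique ys! (avoids⇒disjoint avoids)
        (walkTo-++⁺ D₁ walk-D₁ (x~u , walkTo-++⁺ ys walk-ys (walkTo-restart B walk-B w~y))) (s≤s z≤n)

    reroute : ∀ {D} D₁ z M D₃ → D ≡ D₁ ++ z ∷ M ++ D₃ → Closes t T D → ∀ {u w} →
      lastOr q D₁ ~ u → w ~ lastOr z M → z ~ headOr t D₃ → Path (fromList (cycle D)) u w → Longer D
    reroute D₁ z M D₃ refl (unique , walk) {u} {w} xᵢ~u w~xⱼ z~yⱼ (ys , avoidingWalk walk-ys refl avoids , ys!)
      with walkTo-++⁻ D₁ walk
    ... | walk-D₁ , (_ , walk-zMD₃) with walkTo-++⁻ M walk-zMD₃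
    ...   | walk-M , walk-D₃ =
      splice D₁ (u ∷ ys) (++⁺ʳ D₃ (↭-reverse (z ∷ M))) unique ys! (avoids⇒disjoint avoids)
        (walkTo-++⁺ D₁ walk-D₁ (xᵢ~u , walkTo-++⁺ ys walk-ys reversed)) (s≤s z≤n)
      where
      reversed : WalkTo w (reverse (z ∷ M) ++ D₃) t
      reversed = walkTo-++⁺ (reverse (z ∷ M)) (walk-reverse M walk-M w~xⱼ)
        (subst (λ s → WalkTo s D₃ t) (sym (lastOr-reverse w z M)) (walkTo-restart D₃ walk-D₃ z~yⱼ))

    module Step (D : List (Fin n)) (closes : Closes t T D) (short : length (cycle D) < n) where

      C : Subset n
      C = fromList (cycle D)

      h : Fin n
      h = proj₁ (short-list-misses (cycle D) short)

      h∉C : h ∉ₛ C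
      h∉C = proj₂ (short-list-misses (cycle D) short) ∘ ∈-fromList⁻ (cycle D)

      Attachment : Fin n → Set
      Attachment v = v ∈ₛ C × ∃ λ w → Reach G C h w × v ~ w

      attachment? : ∀ v → Dec (Attachment v)
      attachment? v = (v ∈ₛ? C) ×-dec Finₚ.any? (λ w → reach? C h w ×-dec (v ~? w))

      attachments : Subset n
      attachments = decSubset attachment?

      bridge : ∀ {x y} → x ∈ₛ attachments → y ∈ₛ attachments → ∃₂ λ u w → x ~ u × w ~ y × Path C u w
      bridge x∈ y∈ with ∈-decSubset⁻ attachment? x∈ | ∈-decSubset⁻ attachment? y∈
      ... | _ , u , h↝u , x~u | _ , w , h↝w , y~w =
        u , w , x~u , ~-sym y~w , reach⇒path (reach-trans (reach-sym h↝w) h↝u)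

      Position : Set
      Position = Fin (suc (length D))

      -- The i-th edge of the walk from q through D to t joins before i to after i.
      before : Position → Fin n
      before i = lastOr q (take (toℕ i) D)

      after : Position → Fin n
      after i = headOr t (drop (toℕ i) D)

      Insertable : Set
      Insertable = ∃ λ i → before i ∈ₛ attachments × after i ∈ₛ attachments

      Reroutable : Set
      Reroutable = ∃₂ λ i j → i Fin.< j × before i ∈ₛ attachments × before j ∈ₛ attachments × after i ~ after j

      insertable⇒longer : Insertable → Longer D
      insertable⇒longer (i , x∈ , y∈) with bridge x∈ y∈
      ... | u , w , x~u , w~y , path =
        insert (take (toℕ i) D) (drop (toℕ i) D) (sym (take++drop≡id (toℕ i) D)) closes x~u w~y path

      reroutable⇒longer : Reroutable → Longer D
      reroutable⇒longer (i , j , i<j , xᵢ∈ , xⱼ∈ , yᵢ~yⱼ) with split-between t D i j i<j | bridge xᵢ∈ xⱼ∈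
      ... | D₁ , z , M , D₃ , D≡ , take-i , head-i , take-j , drop-j | u , w , xᵢ~u , w~xⱼ , path =
        reroute D₁ z M D₃ D≡ closes (subst (_~ u) (cong (lastOr q) take-i) xᵢ~u)
          (subst (w ~_) (trans (cong (lastOr q) take-j) (lastOr-++ q D₁ (z ∷ M))) w~xⱼ)
          (subst₂ _~_ head-i (cong (headOr t) drop-j) yᵢ~yⱼ) path

      attachment⁺ : ∀ {v w} → v ∈ₛ C → Reach G C h w → v ~ w → v ∈ₛ attachments
      attachment⁺ v∈C h↝w v~w = ∈-decSubset⁺ attachment? (v∈C , _ , h↝w , v~w)

      after∈cycle : ∀ i → after i ∈ cycle D
      after∈cycle i with ∈-++⁻ D (headOr-drop-∈ t D i)
      ... | inj₁ y∈D        = there (∈-++⁺ʳ T y∈D)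
      ... | inj₂ (here y≡t) = here y≡t

      after-injective : ∀ {i j} → after i ≡ after j → i ≡ j
      after-injective = headOr-drop-injective t D (Unique.++⁺ D! ([] ∷ []) t∉D)
        where
        D! : Unique D
        D! = proj₁ (proj₂ (unique-++⁻ (t ∷ T) (proj₁ closes)))
        t∉D : Disjoint D (t ∷ [])
        t∉D (t∈D , here refl) = proj₂ (proj₂ (unique-++⁻ (t ∷ T) (proj₁ closes))) (here refl , t∈D)

      -- h and the successors of the attached positions are independent, and the attachments,
      -- all of which lie on init t T or precede such a successor, separate h from the cycle.
      module NoSplice (¬insertable : ¬ Insertable) (¬reroutable : ¬ Reroutable) where

        attached? : ∀ i → Dec (before i ∈ₛ attachments)
        attached? i = before i ∈ₛ? attachments

        attached : List Position
        attached = filter attached? (allFin _)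

        attached⁻ : ∀ {i} → i ∈ attached → before i ∈ₛ attachments
        attached⁻ i∈ = proj₂ (∈-filter⁻ attached? {xs = allFin _} i∈)

        attached⁺ : ∀ {i} → before i ∈ₛ attachments → i ∈ attached
        attached⁺ {i} = ∈-filter⁺ attached? (∈-allFin i)

        h≁after : ∀ {i} → i ∈ attached → ¬ h ~ after i
        h≁after {i} i∈ h~y = ¬insertable (i , attached⁻ i∈ ,
          attachment⁺ (∈-fromList⁺ (after∈cycle i)) (here h∉C) (~-sym h~y))

        independent : List (Fin n)
        independent = h ∷ map after attached

        independent-unique : Unique independent
        independent-unique = unique-∷ h∉ (Unique.map⁺ after-injective (Unique.filter⁺ attached? (Unique.allFin⁺ _)))
          where
          h∉ : h ∉ map after attached
          h∉ h∈ with ∈-map⁻ after h∈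
          ... | i , _ , h≡yᵢ = h∉C (subst (_∈ₛ C) (sym h≡yᵢ) (∈-fromList⁺ (after∈cycle i)))

        independent-nonadjacent : ∀ {u v} → u ∈ independent → v ∈ independent → u ≢ v → ¬ u ~ v
        independent-nonadjacent (here refl) (here refl) u≢v = contradiction refl u≢v
        independent-nonadjacent (here refl) (there v∈) _ with ∈-map⁻ after v∈
        ... | _ , j∈ , refl = h≁after j∈
        independent-nonadjacent (there u∈) (here refl) _ with ∈-map⁻ after u∈
        ... | _ , i∈ , refl = h≁after i∈ ∘ ~-sym
        independent-nonadjacent (there u∈) (there v∈) u≢v with ∈-map⁻ after u∈ | ∈-map⁻ after v∈
        ... | i , i∈ , refl | j , j∈ , refl with Finₚ.<-cmp i j
        ...   | tri< i<j _ _ = λ yᵢ~yⱼ → ¬reroutable (i , j , i<j , attached⁻ i∈ , attached⁻ j∈ , yᵢ~yⱼ)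
        ...   | tri≈ _ refl _ = contradiction refl u≢v
        ...   | tri> _ _ j<i = λ yᵢ~yⱼ → ¬reroutable (j , i , j<i , attached⁻ j∈ , attached⁻ i∈ , ~-sym yᵢ~yⱼ)

        attached<α : length attached < a
        attached<α = begin-strict
          length attached                  <⟨ n<1+n _ ⟩
          suc (length attached)            ≡⟨ cong suc (length-map after attached) ⟨
          length independent               ≤⟨ unique⇒length≤∣fromList∣ independent-unique ⟩
          ∣ fromList independent ∣         ≤⟨ α-bound _ (pairwise-nonadjacent⇒independent independent-nonadjacent) ⟩
          a                                ∎
          where open ≤-Reasoning

        trapped : ∀ {v} → Reach G attachments h v → Reach G C h v
        trapped (here _)          = here h∉C
        trapped (step r w~v v∉A) = step (trapped r) w~v (λ v∈C → v∉A (attachment⁺ v∈C (trapped r) (~-sym w~v)))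

        unattached : ∃ λ u → u ∈ₛ C × u ∉ₛ attachments
        unattached with q ∈ₛ? attachments
        ... | no q∉A  = q , ∈-fromList⁺ (∈-++⁺ˡ (lastOr-∈ t T)) , q∉A
        ... | yes q∈A = after zero , ∈-fromList⁺ (after∈cycle zero) , λ y∈A → ¬insertable (zero , q∈A , y∈A)

        separating : Separating G attachments
        separating with unattached
        ... | u , u∈C , u∉A = inj₂ (h , u , h∉C ∘ proj₁ ∘ ∈-decSubset⁻ attachment? , u∉A ,
                                    λ h↝u → reach-end (trapped h↝u) u∈C)

        attachments⊆ : attachments ⊆ fromList (init t T ++ map before attached)
        attachments⊆ {v} v∈A = ∈-fromList⁺ (covered (∈-fromList⁻ (cycle D) (proj₁ (∈-decSubset⁻ attachment? v∈A))))
          where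
          at : ∀ i → v ≡ before i → v ∈ init t T ++ map before attached
          at i v≡ = subst (_∈ _) (sym v≡)
            (∈-++⁺ʳ (init t T) (∈-map⁺ before (attached⁺ {i} (subst (_∈ₛ attachments) v≡ v∈A))))

          covered : v ∈ cycle D → v ∈ init t T ++ map before attached
          covered v∈ with ∈-++⁻ (t ∷ T) v∈
          ... | inj₂ v∈D = let i , v≡ = ∈⇒lastOr-take {p = q} D (there v∈D) in at i v≡
          ... | inj₁ v∈F with ∈-++⁻ (init t T) (subst (v ∈_) (∷≡init∷ʳlastOr t T) v∈F)
          ...   | inj₁ v∈init    = ∈-++⁺ˡ v∈init
          ...   | inj₂ (here v≡q) = at zero v≡q

        κ≤T+attached : k ≤ length T + length attached
        κ≤T+attached = begin
          k                                               ≤⟨ κ-bound attachments separating ⟩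
          ∣ attachments ∣                                 ≤⟨ p⊆q⇒∣p∣≤∣q∣ attachments⊆ ⟩
          ∣ fromList (init t T ++ map before attached) ∣  ≤⟨ ∣fromList∣≤length (init t T ++ map before attached) ⟩
          length (init t T ++ map before attached)        ≡⟨ length-++ (init t T) ⟩
          length (init t T) + length (map before attached) ≡⟨ cong₂ _+_ (length-init t T) (length-map before attached) ⟩
          length T + length attached                      ∎
          where open ≤-Reasoning

        impossible : ⊥
        impossible = <-irrefl refl (begin-strict
          length T + length attached  <⟨ +-monoʳ-< (length T) attached<α ⟩
          length T + a                ≤⟨ T+a≤k ⟩
          k                           ≤⟨ κ≤T+attached ⟩
          length T + length attached  ∎)
          where open ≤-Reasoning

      longer : Longer D
      longer with Finₚ.any? (λ i → (before i ∈ₛ? attachments) ×-dec (after i ∈ₛ? attachments))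
      ... | yes insertable = insertable⇒longer insertable
      ... | no ¬insertable with Finₚ.any? (λ i → Finₚ.any? (λ j → (i Finₚ.<? j) ×-dec
              (before i ∈ₛ? attachments) ×-dec (before j ∈ₛ? attachments) ×-dec (after i ~? after j)))
      ...   | yes reroutable = reroutable⇒longer reroutable
      ...   | no ¬reroutable = ⊥-elim (NoSplice.impossible ¬insertable ¬reroutable)

    saturate : ∀ D → Closes t T D → ∃ λ D′ → Closes t T D′ × length (cycle D′) ≡ n
    saturate D closes = go D closes (<-wellFounded (n ∸ length (cycle D)))
      where
      go : ∀ D → Closes t T D → Acc _<_ (n ∸ length (cycle D)) → ∃ λ D′ → Closes t T D′ × length (cycle D′) ≡ n
      go D closes (acc smaller) with length (cycle D) <? n
      ... | no ¬short = D , closes , ≤-antisym (unique⇒length≤n (proj₁ closes)) (≮⇒≥ ¬short)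
      ... | yes short with Step.longer D closes short
      ...   | D′ , closes′ , D<D′ = go D′ closes′ (smaller (∸-monoʳ-< cycle< (unique⇒length≤n (proj₁ closes′))))
        where
        cycle< : length (cycle D) < length (cycle D′)
        cycle< = s≤s (begin-strict
          length (T ++ D)        ≡⟨ length-++ T ⟩
          length T + length D    <⟨ +-monoʳ-< (length T) D<D′ ⟩
          length T + length D′   ≡⟨ length-++ T ⟨
          length (T ++ D′)       ∎)
          where open ≤-Reasoning

  close-with-edge : ∀ t → 1 ≤ k → ∃ (Closes t [])
  close-with-edge t 1≤k with nonempty? (neighbours t)
  ... | yes (x , x∈N) = x ∷ [] , unique-∷ t∉ ([] ∷ []) , t~x , ~-sym t~x
    where
    t~x : t ~ x
    t~x = ∈-decSubset⁻ (t ~?_) x∈N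
    t∉ : t ∉ x ∷ []
    t∉ (here refl) = ~-irrefl t~x
  ... | no empty = ⊥-elim (<-irrefl refl (begin-strict
    0                    <⟨ 1≤k ⟩
    k                    ≤⟨ κ≤degree t ⟩
    ∣ neighbours t ∣     ≡⟨ cong ∣_∣ (Empty-unique empty) ⟩
    ∣ Subset.⊥ {n} ∣     ≡⟨ ∣⊥∣≡0 n ⟩
    0                    ∎))
    where open ≤-Reasoning

  close-by-detour : ∀ t y T → Unique (t ∷ y ∷ T) → length T < k → ∃ (Closes t (y ∷ T))
  close-by-detour t y T tyT! |T|<k = detour (reach? (fromList I) t q)
    where
    I : List (Fin n)
    I = init y T

    q : Fin n
    q = lastOr y T

    tIq! : Unique (t ∷ I ∷ʳ q)
    tIq! = subst (Unique ∘ (t ∷_)) (∷≡init∷ʳlastOr y T) tyT!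

    I! : Unique I
    I! = proj₁ (unique-++⁻ I (Unique-tail tIq!))

    t∉I∷ʳq : t ∉ I ∷ʳ q
    t∉I∷ʳq t∈ = All.lookup (Unique-head tIq!) t∈ refl

    q∉I : q ∉ₛ fromList I
    q∉I q∈ = proj₂ (proj₂ (unique-++⁻ I (Unique-tail tIq!))) (∈-fromList⁻ I q∈ , here refl)

    detour : Dec (Reach G (fromList I) t q) → ∃ (Closes t (y ∷ T))
    detour (no t↮q) = ⊥-elim (<⇒≱ |T|<k (begin
      k                  ≤⟨ κ-bound (fromList I) (inj₂ (t , q , t∉I∷ʳq ∘ ∈-++⁺ˡ ∘ ∈-fromList⁻ I , q∉I , t↮q)) ⟩
      ∣ fromList I ∣     ≤⟨ ∣fromList∣≤length I ⟩
      length I           ≡⟨ length-init y T ⟩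
      length T           ∎))
      where open ≤-Reasoning
    detour (yes t↝q) with reach⇒path t↝q
    ... | ys , avoidingWalk walk ends avoids , ys! with initLast ys
    ...   | [] = ⊥-elim (t∉I∷ʳq (∈-++⁺ʳ I (here (sym ends))))
    ...   | D ∷ʳ′ x with trans (sym (lastOr-∷ʳ q D x)) ends
    ...     | refl = D , unique-↭ (↭-sym rearranged) (Unique.++⁺ I! ys! (Disjoint-sym (avoids⇒disjoint avoids))) ,
                     walk-∷ʳ⇒walkTo D walk
      where
      rearranged : t ∷ (y ∷ T) ++ D ↭ I ++ q ∷ D ∷ʳ x
      rearranged = begin
        t ∷ (y ∷ T) ++ D     ≡⟨ cong (λ F → t ∷ F ++ D) (∷≡init∷ʳlastOr y T) ⟩
        t ∷ (I ∷ʳ q) ++ D    ≡⟨ cong (t ∷_) (++-assoc I (q ∷ []) D) ⟩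
        t ∷ I ++ q ∷ D       ↭⟨ ∷↭∷ʳ t (I ++ q ∷ D) ⟩
        (I ++ q ∷ D) ∷ʳ t    ≡⟨ ++-assoc I (q ∷ D) (t ∷ []) ⟩
        I ++ q ∷ D ∷ʳ t      ∎
        where open PermutationReasoning

  close-path : ∀ t T → Unique (t ∷ T) → length T + a ≤ k → ∃ (Closes t T)
  close-path t []      _   a≤k   = close-with-edge t (≤-trans (1≤a t) a≤k)
  close-path t (y ∷ T) tT! T+a≤k = close-by-detour t y T tT! (≤-trans (m≤m+n _ a) T+a≤k)

  hamiltonian-cycle : ∀ {r t} T → TriangleChain r t T → Unique (t ∷ T) → r + r + a ≤ k →
    ∃ λ D → Closes t T D × length (t ∷ T ++ D) ≡ n
  hamiltonian-cycle {r} {t} T chain tT! bound = uncurry saturate (close-path t T tT! T+a≤k)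
    where
    T+a≤k : length T + a ≤ k
    T+a≤k = subst (λ l → l + a ≤ k) (sym (chain-length T chain)) bound

    open Extension t T T+a≤k using (saturate)

  closes⇒ContainsCrn : ∀ {r t T} D → TriangleChain r t T → Closes t T D → length (t ∷ T ++ D) ≡ n →
    ContainsCrn G r
  closes⇒ContainsCrn {r} {t} {T} D chain (unique , walk-D) len = σ , σ-injective , consecutive , closing , chord
    where
    walk : WalkTo t (T ++ D) t
    walk = walkTo-++⁺ T (chain-walk T chain) walk-D

    position : Fin n → Fin (length (t ∷ T ++ D))
    position = Fin.cast (sym len)

    toℕ-position : ∀ i → toℕ (position i) ≡ toℕ i
    toℕ-position = Finₚ.toℕ-cast (sym len)

    σ : Fin n → Fin n
    σ i = lookup (t ∷ T ++ D) (position i)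

    σ-injective : ∀ {i j} → σ i ≡ σ j → i ≡ j
    σ-injective {i} {j} σi≡σj = Finₚ.toℕ-injective (begin
      toℕ i             ≡⟨ toℕ-position i ⟨
      toℕ (position i)  ≡⟨ cong toℕ (lookup-injective unique σi≡σj) ⟩
      toℕ (position j)  ≡⟨ toℕ-position j ⟩
      toℕ j             ∎)
      where open ≡-Reasoning

    consecutive : ∀ i j → toℕ j ≡ suc (toℕ i) → σ i ~ σ j
    consecutive i j j≡ = walk-lookup (walkTo⇒walk (T ++ D) walk) (position i) (position j)
      (trans (toℕ-position j) (trans j≡ (cong suc (sym (toℕ-position i)))))

    closing : ∀ i j → suc (toℕ i) ≡ n → toℕ j ≡ 0 → σ i ~ σ j
    closing i j i≡ j≡ =
      subst₂ _~_ (sym (lookup-last t (T ++ D) (position i) i-last)) (sym (lookup-zero (position j) j-first))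
        (walkTo-last (T ++ D) walk)
      where
      i-last : toℕ (position i) ≡ length (T ++ D)
      i-last = suc-injective (trans (cong suc (toℕ-position i)) (trans i≡ (sym len)))
      j-first : toℕ (position j) ≡ 0
      j-first = trans (toℕ-position j) j≡

    chord : ∀ m i j → m < r → toℕ i ≡ 2 * m → toℕ j ≡ 2 * m + 2 → σ i ~ σ j
    chord m i j m<r i≡ j≡ = chain-chord T D chain m<r (position i) (position j)
      (trans (toℕ-position i) (trans i≡ (*-comm 2 m)))
      (trans (toℕ-position j) (trans j≡ (trans (+-comm (2 * m) 2) (cong (2 +_) (*-comm 2 m)))))

  contains-Crn : Fin n → ∀ r → r + r + a ≤ k → ContainsCrn G r
  contains-Crn v₀ r bound with build-chain v₀ r bound
  ... | t , T , chain , tT! with hamiltonian-cycle T chain tT! bound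
  ...   | D , closes , len = closes⇒ContainsCrn D chain closes len

⌊n/2⌋+⌊n/2⌋≤n : ∀ m → ⌊ m /2⌋ + ⌊ m /2⌋ ≤ m
⌊n/2⌋+⌊n/2⌋≤n m = ≤-trans (+-monoʳ-≤ ⌊ m /2⌋ (⌊n/2⌋≤⌈n/2⌉ m)) (≤-reflexive (⌊n/2⌋+⌈n/2⌉≡n m))

theorem2p6 : (n : ℕ) → 3 ≤ n → (G : Graph n) → (a k : ℕ) →
    IsIndependenceNumber G a → IsConnectivity G k → a ≤ k →
    ContainsCrn G ⌊ (k ∸ a) /2⌋
theorem2p6 zero    ()
theorem2p6 (suc n) _ G a k (_ , α-bound) (_ , κ-bound) a≤k =
  Hamiltonian.contains-Crn G α-bound κ-bound zero ⌊ (k ∸ a) /2⌋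
    (≤-trans (+-monoˡ-≤ a (⌊n/2⌋+⌊n/2⌋≤n (k ∸ a))) (≤-reflexive (m∸n+n≡m a≤k)))
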